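{- Let $G=(V,E)$ be a finite graph and $k>0$ an integer with $|V|\ge k$. Then every consistent orientation $O$ of $S_k$ that has no subset belonging to $\mathcal T^*$ also has no subset belonging to $\mathcal T$.
   Context: An (oriented vertex) separation of $G$ is a pair $(A,B)$ of (possibly empty) subsets of $V$ with $A\cup B=V$ and no edge of $G$ between $A\setminus B$ and $B\setminus A$; let $\vec U$ be the set of these. Order them by $(A,B)\le(C,D)$ iff $A\subseteq C$ and $B\supseteq D$; the inverse of $(A,B)$ is $(B,A)$; $\{A,B\}$ denotes the unoriented separation. Its order is $|A\cap B|$. $\vec S_k$ is the set of oriented separations of order $<k$, $S_k$ the set of corresponding unoriented ones. An orientation of $S_k$ is a set $O\subseteq\vec S_k$ containing exactly one of $(A,B),(B,A)$ for each $\{A,B\}\in S_k$; it is consistent if there are no $(A,B),(C,D)\in\vec S_k$ with $\{A,B\}\ne\{C,D\}$, $(A,B)<(C,D)$, $(B,A)\in O$, $(C,D)\in O$. A star is a set $\sigma$ of oriented separations with $(A,B)\ne(B,A)$ for each element and $(A,B)\le(D,C)$ for all distinct $(A,B),(C,D)\in\sigma$. $\mathcal T$ is the set of all sets $\{(A_1,B_1),(A_2,B_2),(A_3,B_3)\}\subseteq\vec U$ (not necessarily distinct) with $G[A_1]\cup G[A_2]\cup G[A_3]=G$; $\mathcal T^*$ is the set of elements of $\mathcal T$ that are stars. -}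

module Defs where

open import Data.Nat using (ℕ; _<_)
open import Data.Fin using (Fin)
open import Data.Fin.Subset using (Subset; _∈_; _∉_; _⊆_; _∩_; ∣_∣)
open import Data.Bool using (Bool; true; false)
open import Data.Product using (_×_; Σ; ∃; _,_)
open import Data.Sum using (_⊎_)
open import Relation.Binary.PropositionalEquality using (_≡_; _≢_)
open import Relation.Nullary using (¬_)

record Graph (n : ℕ) : Set where
  field
    adj   : Fin n → Fin n → Bool
    sym   : ∀ u v → adj u v ≡ adj v u
    irrefl : ∀ v → adj v v ≡ false

open Graph public

Edge : ∀ {n} → Graph n → Fin n → Fin n → Set
Edge G u v = adj G u v ≡ true

Sep : ℕ → Set
Sep n = Subset n × Subset n

module _ {n : ℕ} (G : Graph n) where

  IsSep : Sep n → Set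
  IsSep (A , B) =
    (∀ v → v ∈ A ⊎ v ∈ B) ×
    (∀ u v → u ∈ A → u ∉ B → v ∈ B → v ∉ A → ¬ Edge G u v)

  order : Sep n → ℕ
  order (A , B) = ∣ A ∩ B ∣

  InS : ℕ → Sep n → Set
  InS k s = IsSep s × order s < k

  inv : Sep n → Sep n
  inv (A , B) = (B , A)

  _≤ₛ_ : Sep n → Sep n → Set
  (A , B) ≤ₛ (C , D) = A ⊆ C × D ⊆ B

  _<ₛ_ : Sep n → Sep n → Set
  s <ₛ t = s ≤ₛ t × s ≢ t

  SameUnoriented : Sep n → Sep n → Set
  SameUnoriented s t = s ≡ t ⊎ s ≡ inv t

  IsOrientation : ℕ → (Sep n → Set) → Set
  IsOrientation k O =
    (∀ s → O s → InS k s) ×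
    (∀ s → InS k s → (O s ⊎ O (inv s)) × ¬ (O s × O (inv s)))

  IsConsistent : ℕ → (Sep n → Set) → Set
  IsConsistent k O =
    ¬ (Σ (Sep n) λ s → Σ (Sep n) λ t →
         InS k s × InS k t × ¬ SameUnoriented s t × s <ₛ t ×
         O (inv s) × O t)

  CoversG : Subset n → Subset n → Subset n → Set
  CoversG A₁ A₂ A₃ =
    (∀ v → v ∈ A₁ ⊎ v ∈ A₂ ⊎ v ∈ A₃) ×
    (∀ u v → Edge G u v →
       (u ∈ A₁ × v ∈ A₁) ⊎ (u ∈ A₂ × v ∈ A₂) ⊎ (u ∈ A₃ × v ∈ A₃))

  -- {s₁,s₂,s₃} ∈ 𝒯  (not necessarily distinct)
  InT : Sep n → Sep n → Sep n → Set
  InT s₁ s₂ s₃ =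
    IsSep s₁ × IsSep s₂ × IsSep s₃ ×
    CoversG (Data.Product.proj₁ s₁) (Data.Product.proj₁ s₂) (Data.Product.proj₁ s₃)

  Nondeg : Sep n → Set
  Nondeg s = s ≢ inv s

  StarPair : Sep n → Sep n → Set
  StarPair s t = s ≢ t → s ≤ₛ inv t

  IsStar3 : Sep n → Sep n → Sep n → Set
  IsStar3 s₁ s₂ s₃ =
    Nondeg s₁ × Nondeg s₂ × Nondeg s₃ ×
    StarPair s₁ s₂ × StarPair s₂ s₁ ×
    StarPair s₁ s₃ × StarPair s₃ s₁ ×
    StarPair s₂ s₃ × StarPair s₃ s₂

  InTStar : Sep n → Sep n → Sep n → Set
  InTStar s₁ s₂ s₃ = InT s₁ s₂ s₃ × IsStar3 s₁ s₂ s₃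

  HasSubsetIn : (Sep n → Set) → (Sep n → Sep n → Sep n → Set) → Set
  HasSubsetIn O P =
    Σ (Sep n) λ s₁ → Σ (Sep n) λ s₂ → Σ (Sep n) λ s₃ →
      O s₁ × O s₂ × O s₃ × P s₁ s₂ s₃

-- Start from an element {s₁, s₂, s₃} of 𝒯 inside O. If it is not a star, some
-- pair, say s₁ = (A, B) and s₂ = (C, D), has s₁ ≰ s₂*. By submodularity of the
-- order one of the corners (A ∩ D, B ∪ C) ≤ s₁ or (C ∩ B, D ∪ A) ≤ s₂ has
-- order < k; replacing s₁ (resp. s₂) by it keeps the triple in 𝒯, and
-- consistency forces O to contain the corner rather than its inverse, unless
-- the corner is s₁* itself, in which case A = V and {s₁} ∈ 𝒯*. The corner lies
-- strictly below s₁, so μ(A, B) = |A| + |V ∖ B| decreases and the process ends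
-- in an element of 𝒯* inside O.
module Submission where

open import Defs
open import Data.Bool.Properties using (_≟_; not-injective)
open import Data.Empty using (⊥-elim)
open import Data.Fin.Subset
  using (Subset; inside; outside; _∈_; _⊆_; _∩_; _∪_; ∁; ∣_∣; ⊤)
open import Data.Fin.Subset.Properties
  using (_∈?_; _⊆?_; x∈p∩q⁺; x∈p∩q⁻; x∈p∪q⁺; x∈p∪q⁻; drop-∷-⊆; p⊆q⇒∣p∣≤∣q∣; p⊆q⇒∁p⊇∁q; ∣⊤∣≡n)
open import Data.Nat using (ℕ; suc; _≥_; _>_; _+_; _≤_; _<_; s≤s; _<?_)
open import Data.Nat.Induction using (<-wellFounded)
open import Data.Nat.Properties
  using (+-suc; +-comm; +-assoc; ≮⇒≥; <-irrefl; ≤-<-trans; +-cancelˡ-<; +-mono-≤; +-mono-<;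
         +-mono-<-≤; +-monoˡ-≤; +-monoˡ-<; +-monoʳ-<; module ≤-Reasoning)
open import Data.Product using (_×_; _,_; proj₁; proj₂; swap)
open import Data.Product.Properties using () renaming (≡-dec to ×-≡-dec)
open import Data.Sum using (_⊎_; inj₁; inj₂; [_,_]; map₁; map₂; assocˡ; assocʳ; reduce)
import Data.Sum as Sum
open import Data.Vec using ([]; _∷_; here)
open import Data.Vec.Properties using (∷-injectiveˡ; ∷-injectiveʳ; ≡-dec)
open import Function using (id; _∘_; const)
open import Induction.WellFounded using (Acc; acc)
open import Relation.Binary.Definitions using (DecidableEquality)
open import Relation.Binary.PropositionalEquality
  using (_≡_; _≢_; refl; cong; cong₂; subst; trans; module ≡-Reasoning)
import Relation.Binary.PropositionalEquality as ≡
open import Relation.Nullary using (¬_; Dec; yes; no; contradiction)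
open import Relation.Nullary.Decidable using (_×-dec_)

_≟ˢ_ : ∀ {n} → DecidableEquality (Subset n)
_≟ˢ_ = ≡-dec _≟_

∁-injective : ∀ {n} {p q : Subset n} → ∁ p ≡ ∁ q → p ≡ q
∁-injective {p = []}    {[]}    _  = refl
∁-injective {p = _ ∷ _} {_ ∷ _} eq =
  cong₂ _∷_ (not-injective (∷-injectiveˡ eq)) (∁-injective (∷-injectiveʳ eq))

p⊆q∧p≢q⇒∣p∣<∣q∣ : ∀ {n} {p q : Subset n} → p ⊆ q → p ≢ q → ∣ p ∣ < ∣ q ∣
p⊆q∧p≢q⇒∣p∣<∣q∣ {p = []}          {[]}          _   p≢q = contradiction refl p≢q
p⊆q∧p≢q⇒∣p∣<∣q∣ {p = outside ∷ p} {outside ∷ q} p⊆q p≢q =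
  p⊆q∧p≢q⇒∣p∣<∣q∣ (drop-∷-⊆ p⊆q) (p≢q ∘ cong (outside ∷_))
p⊆q∧p≢q⇒∣p∣<∣q∣ {p = outside ∷ p} {inside  ∷ q} p⊆q _   = s≤s (p⊆q⇒∣p∣≤∣q∣ (drop-∷-⊆ p⊆q))
p⊆q∧p≢q⇒∣p∣<∣q∣ {p = inside  ∷ p} {outside ∷ q} p⊆q _   = contradiction (p⊆q here) λ ()
p⊆q∧p≢q⇒∣p∣<∣q∣ {p = inside  ∷ p} {inside  ∷ q} p⊆q p≢q =
  s≤s (p⊆q∧p≢q⇒∣p∣<∣q∣ (drop-∷-⊆ p⊆q) (p≢q ∘ cong (inside ∷_)))

∣p∪q∣+∣p∩q∣≡∣p∣+∣q∣ : ∀ {n} (p q : Subset n) → ∣ p ∪ q ∣ + ∣ p ∩ q ∣ ≡ ∣ p ∣ + ∣ q ∣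
∣p∪q∣+∣p∩q∣≡∣p∣+∣q∣ []            []            = refl
∣p∪q∣+∣p∩q∣≡∣p∣+∣q∣ (outside ∷ p) (outside ∷ q) = ∣p∪q∣+∣p∩q∣≡∣p∣+∣q∣ p q
∣p∪q∣+∣p∩q∣≡∣p∣+∣q∣ (outside ∷ p) (inside  ∷ q) =
  trans (cong suc (∣p∪q∣+∣p∩q∣≡∣p∣+∣q∣ p q)) (≡.sym (+-suc ∣ p ∣ ∣ q ∣))
∣p∪q∣+∣p∩q∣≡∣p∣+∣q∣ (inside  ∷ p) (outside ∷ q) = cong suc (∣p∪q∣+∣p∩q∣≡∣p∣+∣q∣ p q)
∣p∪q∣+∣p∩q∣≡∣p∣+∣q∣ (inside  ∷ p) (inside  ∷ q) = cong suc (begin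
  ∣ p ∪ q ∣ + suc ∣ p ∩ q ∣ ≡⟨ +-suc ∣ p ∪ q ∣ ∣ p ∩ q ∣ ⟩
  suc (∣ p ∪ q ∣ + ∣ p ∩ q ∣) ≡⟨ cong suc (∣p∪q∣+∣p∩q∣≡∣p∣+∣q∣ p q) ⟩
  suc (∣ p ∣ + ∣ q ∣)         ≡⟨ ≡.sym (+-suc ∣ p ∣ ∣ q ∣) ⟩
  ∣ p ∣ + suc ∣ q ∣           ∎)
  where open ≡-Reasoning

m+n<o+o⇒m<o⊎n<o : ∀ {m n o} → m + n < o + o → m < o ⊎ n < o
m+n<o+o⇒m<o⊎n<o {m} {n} {o} m+n<o+o with m <? o
... | yes m<o = inj₁ m<o
... | no  m≮o = inj₂ (+-cancelˡ-< o n o (≤-<-trans (+-monoˡ-≤ n (≮⇒≥ m≮o)) m+n<o+o))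

-- The infimum of s and t*: the corner of the two separations that lies below s.
corner : ∀ {n} → Sep n → Sep n → Sep n
corner (A , B) (C , D) = A ∩ D , B ∪ C

corner≡inv⇒full : ∀ {n} {A B C D : Subset n} → (∀ v → v ∈ A ⊎ v ∈ B) →
                  corner (A , B) (C , D) ≡ (B , A) → ∀ v → v ∈ A
corner≡inv⇒full {A = A} {D = D} cover eq v =
  [ id , (λ v∈B → proj₁ (x∈p∩q⁻ A D (subst (v ∈_) (≡.sym (cong proj₁ eq)) v∈B))) ] (cover v)

μ : ∀ {n} → Sep n → ℕ
μ (A , B) = ∣ A ∣ + ∣ ∁ B ∣

module _ {n : ℕ} (G : Graph n) where

  Edge-sym : ∀ {u v} → Edge G u v → Edge G v u
  Edge-sym {u} {v} uv = trans (sym G v u) uv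

  Splits : Subset n → Subset n → Set
  Splits A B =
    (∀ v → v ∈ A ⊎ v ∈ B) ×
    (∀ {u v} → Edge G u v → (u ∈ A × v ∈ A) ⊎ (u ∈ B × v ∈ B))

  IsSep⇒Splits : ∀ {A B} → IsSep G (A , B) → Splits A B
  IsSep⇒Splits {A} {B} (cover , noEdge) = cover , split
    where
    ∉B⇒∈A : ∀ {v} → ¬ v ∈ B → v ∈ A
    ∉B⇒∈A {v} v∉B = [ id , (λ v∈B → contradiction v∈B v∉B) ] (cover v)

    ∉A⇒∈B : ∀ {v} → ¬ v ∈ A → v ∈ B
    ∉A⇒∈B {v} v∉A = [ (λ v∈A → contradiction v∈A v∉A) , id ] (cover v)

    split : ∀ {u v} → Edge G u v → (u ∈ A × v ∈ A) ⊎ (u ∈ B × v ∈ B)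
    split {u} {v} uv with u ∈? B | v ∈? B
    ... | yes u∈B | yes v∈B = inj₂ (u∈B , v∈B)
    ... | no  u∉B | _ with v ∈? A
    ...   | yes v∈A = inj₁ (∉B⇒∈A u∉B , v∈A)
    ...   | no  v∉A = ⊥-elim (noEdge u v (∉B⇒∈A u∉B) u∉B (∉A⇒∈B v∉A) v∉A uv)
    split {u} {v} uv | yes u∈B | no v∉B with u ∈? A
    ...   | yes u∈A = inj₁ (u∈A , ∉B⇒∈A v∉B)
    ...   | no  u∉A = ⊥-elim (noEdge v u (∉B⇒∈A v∉B) v∉B u∈B u∉A (Edge-sym uv))

  Splits⇒IsSep : ∀ {A B} → Splits A B → IsSep G (A , B)
  Splits⇒IsSep (cover , split) = cover , λ u v _ u∉B _ v∉A uv →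
    [ (λ (_ , v∈A) → v∉A v∈A) , (λ (u∈B , _) → u∉B u∈B) ] (split uv)

  corner-splits : ∀ {A B C D} → Splits A B → Splits C D → Splits (A ∩ D) (B ∪ C)
  corner-splits {A} {B} {C} {D} (coverAB , splitAB) (coverCD , splitCD) = cover , split
    where
    cover : ∀ v → v ∈ A ∩ D ⊎ v ∈ B ∪ C
    cover v with coverAB v | coverCD v
    ... | inj₂ v∈B | _        = inj₂ (x∈p∪q⁺ (inj₁ v∈B))
    ... | inj₁ _   | inj₁ v∈C = inj₂ (x∈p∪q⁺ (inj₂ v∈C))
    ... | inj₁ v∈A | inj₂ v∈D = inj₁ (x∈p∩q⁺ (v∈A , v∈D))

    split : ∀ {u v} → Edge G u v → (u ∈ A ∩ D × v ∈ A ∩ D) ⊎ (u ∈ B ∪ C × v ∈ B ∪ C)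
    split uv with splitAB uv | splitCD uv
    ... | inj₂ (u∈B , v∈B) | _ = inj₂ (x∈p∪q⁺ (inj₁ u∈B) , x∈p∪q⁺ (inj₁ v∈B))
    ... | inj₁ _ | inj₁ (u∈C , v∈C) = inj₂ (x∈p∪q⁺ (inj₂ u∈C) , x∈p∪q⁺ (inj₂ v∈C))
    ... | inj₁ (u∈A , v∈A) | inj₂ (u∈D , v∈D) = inj₁ (x∈p∩q⁺ (u∈A , u∈D) , x∈p∩q⁺ (v∈A , v∈D))

  corner-isSep : ∀ {s t} → IsSep G s → IsSep G t → IsSep G (corner s t)
  corner-isSep s-sep t-sep = Splits⇒IsSep (corner-splits (IsSep⇒Splits s-sep) (IsSep⇒Splits t-sep))

  CoversG-∩ : ∀ {A₁ A₂ A₃ B₂} → CoversG G A₁ A₂ A₃ → Splits A₂ B₂ → CoversG G (A₁ ∩ B₂) A₂ A₃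
  CoversG-∩ {A₁} {A₂} {A₃} {B₂} (cover , split) (cover₂ , split₂) = cover′ , split′
    where
    cover′ : ∀ v → v ∈ A₁ ∩ B₂ ⊎ v ∈ A₂ ⊎ v ∈ A₃
    cover′ v with cover v | cover₂ v
    ... | inj₂ v∈A₂₃ | _        = inj₂ v∈A₂₃
    ... | inj₁ _     | inj₁ v∈A₂ = inj₂ (inj₁ v∈A₂)
    ... | inj₁ v∈A₁ | inj₂ v∈B₂ = inj₁ (x∈p∩q⁺ (v∈A₁ , v∈B₂))

    split′ : ∀ u v → Edge G u v →
             (u ∈ A₁ ∩ B₂ × v ∈ A₁ ∩ B₂) ⊎ (u ∈ A₂ × v ∈ A₂) ⊎ (u ∈ A₃ × v ∈ A₃)
    split′ u v uv with split u v uv | split₂ uv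
    ... | inj₂ uv∈A₂₃ | _ = inj₂ uv∈A₂₃
    ... | inj₁ _ | inj₁ uv∈A₂ = inj₂ (inj₁ uv∈A₂)
    ... | inj₁ (u∈A₁ , v∈A₁) | inj₂ (u∈B₂ , v∈B₂) =
      inj₁ (x∈p∩q⁺ (u∈A₁ , u∈B₂) , x∈p∩q⁺ (v∈A₁ , v∈B₂))

  CoversG-permute : ∀ {A₁ A₂ A₃ B₁ B₂ B₃} →
    (∀ {P : Subset n → Set} → P A₁ ⊎ P A₂ ⊎ P A₃ → P B₁ ⊎ P B₂ ⊎ P B₃) →
    CoversG G A₁ A₂ A₃ → CoversG G B₁ B₂ B₃
  CoversG-permute π (cover , split) =
    (λ v → π {v ∈_} (cover v)) , (λ u v uv → π {λ X → u ∈ X × v ∈ X} (split u v uv))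

  corner-order-submodular : ∀ s t →
    order G (corner s t) + order G (corner t s) ≤ order G s + order G t
  corner-order-submodular (A , B) (C , D) = begin
    ∣ X ∣ + ∣ Y ∣          ≡⟨ ≡.sym (∣p∪q∣+∣p∩q∣≡∣p∣+∣q∣ X Y) ⟩
    ∣ X ∪ Y ∣ + ∣ X ∩ Y ∣  ≤⟨ +-mono-≤ (p⊆q⇒∣p∣≤∣q∣ X∪Y⊆P∪Q) (p⊆q⇒∣p∣≤∣q∣ X∩Y⊆P∩Q) ⟩
    ∣ P ∪ Q ∣ + ∣ P ∩ Q ∣  ≡⟨ ∣p∪q∣+∣p∩q∣≡∣p∣+∣q∣ P Q ⟩
    ∣ P ∣ + ∣ Q ∣          ∎
    where
    open ≤-Reasoning
    X = (A ∩ D) ∩ (B ∪ C)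
    Y = (C ∩ B) ∩ (D ∪ A)
    P = A ∩ B
    Q = C ∩ D

    X∩Y⊆P∩Q : X ∩ Y ⊆ P ∩ Q
    X∩Y⊆P∩Q x∈X∩Y =
      let x∈X , x∈Y = x∈p∩q⁻ X Y x∈X∩Y
          x∈A , x∈D = x∈p∩q⁻ A D (proj₁ (x∈p∩q⁻ (A ∩ D) (B ∪ C) x∈X))
          x∈C , x∈B = x∈p∩q⁻ C B (proj₁ (x∈p∩q⁻ (C ∩ B) (D ∪ A) x∈Y))
      in x∈p∩q⁺ (x∈p∩q⁺ (x∈A , x∈B) , x∈p∩q⁺ (x∈C , x∈D))

    X∪Y⊆P∪Q : X ∪ Y ⊆ P ∪ Q
    X∪Y⊆P∪Q x∈X∪Y with x∈p∪q⁻ X Y x∈X∪Y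
    ... | inj₁ x∈X =
      let x∈A∩D , x∈B∪C = x∈p∩q⁻ (A ∩ D) (B ∪ C) x∈X
          x∈A , x∈D = x∈p∩q⁻ A D x∈A∩D
      in x∈p∪q⁺ (Sum.map (λ x∈B → x∈p∩q⁺ (x∈A , x∈B)) (λ x∈C → x∈p∩q⁺ (x∈C , x∈D))
                         (x∈p∪q⁻ B C x∈B∪C))
    ... | inj₂ x∈Y =
      let x∈C∩B , x∈D∪A = x∈p∩q⁻ (C ∩ B) (D ∪ A) x∈Y
          x∈C , x∈B = x∈p∩q⁻ C B x∈C∩B
      in x∈p∪q⁺ (Sum.swap (Sum.map (λ x∈D → x∈p∩q⁺ (x∈C , x∈D)) (λ x∈A → x∈p∩q⁺ (x∈A , x∈B))
                                   (x∈p∪q⁻ D A x∈D∪A)))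

  corner-order< : ∀ {k} s t → order G s < k → order G t < k →
                  order G (corner s t) < k ⊎ order G (corner t s) < k
  corner-order< s t s<k t<k =
    m+n<o+o⇒m<o⊎n<o (≤-<-trans (corner-order-submodular s t) (+-mono-< s<k t<k))

  _≤ₛ?_ : ∀ s t → Dec (_≤ₛ_ G s t)
  (A , B) ≤ₛ? (C , D) = (A ⊆? C) ×-dec (D ⊆? B)

  corner-<ₛ : ∀ {s t} → ¬ _≤ₛ_ G s (inv G t) → _<ₛ_ G (corner s t) s
  corner-<ₛ {A , B} {C , D} s≰t* =
    ((proj₁ ∘ x∈p∩q⁻ A D) , (x∈p∪q⁺ ∘ inj₁)) , λ eq → s≰t* (A⊆D eq , C⊆B eq)
    where
    A⊆D : corner (A , B) (C , D) ≡ (A , B) → A ⊆ D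
    A⊆D eq {x} x∈A = proj₂ (x∈p∩q⁻ A D (subst (x ∈_) (≡.sym (cong proj₁ eq)) x∈A))

    C⊆B : corner (A , B) (C , D) ≡ (A , B) → C ⊆ B
    C⊆B eq {x} x∈C = subst (x ∈_) (cong proj₂ eq) (x∈p∪q⁺ (inj₂ x∈C))

  μ-mono-< : ∀ {s t} → _<ₛ_ G s t → μ s < μ t
  μ-mono-< {A , B} {C , D} ((A⊆C , D⊆B) , s≢t) with A ≟ˢ C
  ... | yes refl = +-monoʳ-< ∣ A ∣
        (p⊆q∧p≢q⇒∣p∣<∣q∣ (p⊆q⇒∁p⊇∁q D⊆B) (s≢t ∘ cong (A ,_) ∘ ∁-injective))
  ... | no  A≢C  = +-mono-<-≤ (p⊆q∧p≢q⇒∣p∣<∣q∣ A⊆C A≢C) (p⊆q⇒∣p∣≤∣q∣ (p⊆q⇒∁p⊇∁q D⊆B))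

  InS⇒Nondeg : ∀ {k s} → n ≥ k → InS G k s → Nondeg G s
  InS⇒Nondeg {k} {A , B} n≥k ((cover , _) , order<k) s≡s* with cong proj₁ s≡s*
  ... | refl = <-irrefl refl (begin-strict
    n          ≡⟨ ≡.sym (∣⊤∣≡n n) ⟩
    ∣ ⊤ {n} ∣  ≤⟨ p⊆q⇒∣p∣≤∣q∣ {p = ⊤} (λ {v} _ → x∈p∩q⁺ (reduce (cover v) , reduce (cover v))) ⟩
    ∣ A ∩ A ∣  <⟨ order<k ⟩
    k          ≤⟨ n≥k ⟩
    n          ∎)
    where open ≤-Reasoning

module _ {n : ℕ} (G : Graph n) {k : ℕ} (n≥k : n ≥ k) {O : Sep n → Set}
         (isO : IsOrientation G k O) (con : IsConsistent G k O) where

  O⇒InS : ∀ {s} → O s → InS G k s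
  O⇒InS = proj₁ isO _

  Star : Set
  Star = HasSubsetIn G O (InTStar G)

  full⇒star : ∀ {s} → O s → (∀ v → v ∈ proj₁ s) → Star
  full⇒star {s} os full =
    s , s , s , os , os , os , (s-sep , s-sep , s-sep , covers) ,
    (nondeg , nondeg , nondeg , s≢s⇒ , s≢s⇒ , s≢s⇒ , s≢s⇒ , s≢s⇒ , s≢s⇒)
    where
    s-sep = proj₁ (O⇒InS os)
    nondeg = InS⇒Nondeg G n≥k (O⇒InS os)
    s≢s⇒ : StarPair G s s
    s≢s⇒ s≢s = contradiction refl s≢s
    covers : CoversG G (proj₁ s) (proj₁ s) (proj₁ s)
    covers = (λ v → inj₁ (full v)) , (λ u v _ → inj₁ (full u , full v))

  -- Consistency rules out the inverse of a corner, except when the corner is s*.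
  corner-oriented : ∀ {s t} → O s → ¬ _≤ₛ_ G s (inv G t) → InS G k (corner s t) →
                    O (corner s t) ⊎ (∀ v → v ∈ proj₁ s)
  corner-oriented {s} {t} os s≰t* c∈S with proj₁ (proj₂ isO (corner s t) c∈S)
  ... | inj₁ oc  = inj₁ oc
  ... | inj₂ oc* with ×-≡-dec _≟ˢ_ _≟ˢ_ (corner s t) (inv G s)
  ...   | yes c≡s* = inj₂ (corner≡inv⇒full (proj₁ (proj₁ (O⇒InS os))) c≡s*)
  ...   | no  c≢s* = ⊥-elim (con (corner s t , s , c∈S , O⇒InS os ,
                                   [ proj₂ c<s , c≢s* ] , c<s , oc* , os))
    where c<s = corner-<ₛ G s≰t*

  record Triple : Set where
    constructor triple
    field
      {s₁ s₂ s₃} : Sep n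
      o₁ : O s₁
      o₂ : O s₂
      o₃ : O s₃
      inT : InT G s₁ s₂ s₃
  open Triple

  weight : Triple → ℕ
  weight τ = μ (s₁ τ) + μ (s₂ τ) + μ (s₃ τ)

  data Progress (τ : Triple) : Set where
    done : Star → Progress τ
    next : ∀ τ′ → weight τ′ < weight τ → Progress τ

  Progress-resp : ∀ {τ τ′} → weight τ′ ≡ weight τ → Progress τ′ → Progress τ
  Progress-resp eq (done σ)      = done σ
  Progress-resp eq (next τ″ lt) = next τ″ (subst (weight τ″ <_) eq lt)

  swap₁₂ : Triple → Triple
  swap₁₂ τ = let p₁ , p₂ , p₃ , covers = inT τ in
    triple (o₂ τ) (o₁ τ) (o₃ τ)
           (p₂ , p₁ , p₃ , CoversG-permute G (assocʳ ∘ map₁ Sum.swap ∘ assocˡ) covers)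

  swap₂₃ : Triple → Triple
  swap₂₃ τ = let p₁ , p₂ , p₃ , covers = inT τ in
    triple (o₁ τ) (o₃ τ) (o₂ τ) (p₁ , p₃ , p₂ , CoversG-permute G (map₂ Sum.swap) covers)

  weight-swap₁₂ : ∀ τ → weight (swap₁₂ τ) ≡ weight τ
  weight-swap₁₂ τ = cong (_+ μ (s₃ τ)) (+-comm (μ (s₂ τ)) (μ (s₁ τ)))

  weight-swap₂₃ : ∀ τ → weight (swap₂₃ τ) ≡ weight τ
  weight-swap₂₃ τ = begin
    a + c + b    ≡⟨ +-assoc a c b ⟩
    a + (c + b)  ≡⟨ cong (a +_) (+-comm c b) ⟩
    a + (b + c)  ≡⟨ ≡.sym (+-assoc a b c) ⟩
    a + b + c    ∎
    where
    open ≡-Reasoning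
    a = μ (s₁ τ)
    b = μ (s₂ τ)
    c = μ (s₃ τ)

  replace₁ : ∀ τ → ¬ _≤ₛ_ G (s₁ τ) (inv G (s₂ τ)) → order G (corner (s₁ τ) (s₂ τ)) < k → Progress τ
  replace₁ (triple o₁ o₂ o₃ (p₁ , p₂ , p₃ , covers)) s₁≰s₂* c<k
    with corner-oriented o₁ s₁≰s₂* (corner-isSep G p₁ p₂ , c<k)
  ... | inj₂ full = done (full⇒star o₁ full)
  ... | inj₁ oc   = next (triple oc o₂ o₃ (corner-isSep G p₁ p₂ , p₂ , p₃ , covers′))
                         (+-monoˡ-< _ (+-monoˡ-< _ (μ-mono-< G (corner-<ₛ G s₁≰s₂*))))
    where covers′ = CoversG-∩ G covers (IsSep⇒Splits G p₂)

  improve₁₂ : ∀ τ → ¬ _≤ₛ_ G (s₁ τ) (inv G (s₂ τ)) → Progress τ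
  improve₁₂ τ s₁≰s₂*
    with corner-order< G (s₁ τ) (s₂ τ) (proj₂ (O⇒InS (o₁ τ))) (proj₂ (O⇒InS (o₂ τ)))
  ... | inj₁ c₁₂<k = replace₁ τ s₁≰s₂* c₁₂<k
  ... | inj₂ c₂₁<k = Progress-resp (weight-swap₁₂ τ) (replace₁ (swap₁₂ τ) (s₁≰s₂* ∘ swap) c₂₁<k)

  star : ∀ τ → _≤ₛ_ G (s₁ τ) (inv G (s₂ τ)) → _≤ₛ_ G (s₁ τ) (inv G (s₃ τ)) →
         _≤ₛ_ G (s₂ τ) (inv G (s₃ τ)) → Star
  star (triple o₁ o₂ o₃ T) p₁₂ p₁₃ p₂₃ =
    _ , _ , _ , o₁ , o₂ , o₃ , T ,
    (nondeg o₁ , nondeg o₂ , nondeg o₃ ,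
     const p₁₂ , const (swap p₁₂) , const p₁₃ , const (swap p₁₃) , const p₂₃ , const (swap p₂₃))
    where
    nondeg : ∀ {s} → O s → Nondeg G s
    nondeg = InS⇒Nondeg G n≥k ∘ O⇒InS

  improve : ∀ τ → Progress τ
  improve τ with _≤ₛ?_ G (s₁ τ) (inv G (s₂ τ)) | _≤ₛ?_ G (s₁ τ) (inv G (s₃ τ))
               | _≤ₛ?_ G (s₂ τ) (inv G (s₃ τ))
  ... | yes p₁₂ | yes p₁₃ | yes p₂₃ = done (star τ p₁₂ p₁₃ p₂₃)
  ... | no ¬p₁₂ | _ | _ = improve₁₂ τ ¬p₁₂
  ... | _ | no ¬p₁₃ | _ = Progress-resp (weight-swap₂₃ τ) (improve₁₂ (swap₂₃ τ) ¬p₁₃)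
  ... | _ | _ | no ¬p₂₃ =
    Progress-resp (trans (weight-swap₂₃ (swap₁₂ τ)) (weight-swap₁₂ τ))
                  (improve₁₂ (swap₂₃ (swap₁₂ τ)) ¬p₂₃)

  descend : ∀ τ → Acc _<_ (weight τ) → Star
  descend τ (acc smaller) with improve τ
  ... | done σ     = σ
  ... | next τ′ lt = descend τ′ (smaller lt)

lemma4p2 : (n : ℕ) (G : Graph n) (k : ℕ) → k > 0 → n ≥ k →
    (O : Sep n → Set) → IsOrientation G k O → IsConsistent G k O →
    ¬ HasSubsetIn G O (InTStar G) → ¬ HasSubsetIn G O (InT G)
lemma4p2 n G k _ n≥k O isO con no-star (_ , _ , _ , o₁ , o₂ , o₃ , T) =
  no-star (descend G n≥k isO con τ (<-wellFounded (weight G n≥k isO con τ)))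
  where τ = triple o₁ o₂ o₃ T
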